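{- Let $a\in\mathbb{N}$ with $a\geq 3$, and let $(d_2,\ldots,d_{a-1})\in\mathbb{N}^{a-2}$ satisfy $\sum_{i=2}^{a-1}d_if_i\geq f_a$. Then there exists $(c_2,\ldots,c_{a-1})\in\mathbb{N}^{a-2}$ such that $\sum_{i=2}^{a-1}d_if_i=f_a+\sum_{i=2}^{a-1}c_if_i$ and $\sum_{i=2}^{a-1}c_i<\sum_{i=2}^{a-1}d_i$.
   Context: $\{f_n\}$ is the Fibonacci sequence ($f_0=0$, $f_1=1$, $f_{n+2}=f_{n+1}+f_n$). -}

module Defs where

open import Data.Nat using (ℕ; zero; suc; _+_; _*_)
open import Data.Fin using (Fin; toℕ)
open import Data.Fin using () renaming (zero to fzero; suc to fsuc)

fib : ℕ → ℕ
fib zero = 0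
fib (suc zero) = 1
fib (suc (suc n)) = fib (suc n) + fib n

sumFin : (n : ℕ) → (Fin n → ℕ) → ℕ
sumFin zero g = 0
sumFin (suc n) g = g fzero + sumFin n (λ j → g (fsuc j))

-- A tuple (d_2, …, d_{a-1}) ∈ ℕ^{a-2} is a function d : Fin (a ∸ 2) → ℕ,
-- with index j ∈ Fin (a ∸ 2) standing for i = j + 2.
-- weightedFib n d = Σ_{i=2}^{n+1} d_i f_i
weightedFib : (n : ℕ) → (Fin n → ℕ) → ℕ
weightedFib n d = sumFin n (λ j → d j * fib (toℕ j + 2))

-- Read d as a purse holding d_i coins of value f_i.  More generally, when the coins have values
-- f₂, …, f_{n+1}, every f_k with k ≥ n + 1 that the purse covers can be paid out of it so that
-- the change takes fewer coins; induct on n.  Since f_{k+2} = f_{k+1} + f_k can be paid in two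
-- instalments, only f_{n+1} and f_{n+2} remain.  Without top coins (value f_{n+1}) the lower
-- coins cover the target and we recurse.  A top coin pays f_{n+1}.  For f_{n+2} = f_{n+1} + f_n,
-- one top coin pays f_{n+1} and the lower coins pay f_n, while two top coins pay f_{n+2} with
-- change 2 f_{n+1} − f_{n+2} = f_{n−1}, which takes at most one coin.
{-# OPTIONS --safe #-}
module Submission where

open import Defs
open import Data.Nat using (ℕ; zero; suc; _+_; _*_; _∸_; _≤_; _<_; s≤s; z≤n)
open import Data.Nat.Properties
open import Data.Nat.Tactic.RingSolver using (solve-∀)
open import Data.Fin using (Fin; toℕ; zero; suc)
open import Data.Fin.Properties using (toℕ-inject₁; toℕ-fromℕ)
open import Data.Vec.Functional using (Vector; head; tail; init; last; replicate)
open import Data.Product using (Σ-syntax; _×_; _,_)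
open import Data.Empty using (⊥-elim)
open import Relation.Binary.PropositionalEquality
open import Algebra.Properties.CommutativeMonoid.Sum +-0-commutativeMonoid
  using (sum; sum-cong-≗; sum-init-last; ∑-distrib-+; sum-replicate-zero)

module _ {A : Set} where

  _∷ʳ_ : ∀ {n} → Vector A n → A → Vector A (suc n)
  _∷ʳ_ {zero}  _  x _       = x
  _∷ʳ_ {suc n} xs x zero    = head xs
  _∷ʳ_ {suc n} xs x (suc i) = (tail xs ∷ʳ x) i

  init-∷ʳ : ∀ {n} (xs : Vector A n) x → init (xs ∷ʳ x) ≗ xs
  init-∷ʳ {suc n} xs x zero    = refl
  init-∷ʳ {suc n} xs x (suc i) = init-∷ʳ (tail xs) x i

  last-∷ʳ : ∀ {n} (xs : Vector A n) x → last (xs ∷ʳ x) ≡ x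
  last-∷ʳ {zero}  xs x = refl
  last-∷ʳ {suc n} xs x = last-∷ʳ (tail xs) x

  init-∷ʳ-last : ∀ {n} (xs : Vector A (suc n)) → init xs ∷ʳ last xs ≗ xs
  init-∷ʳ-last {zero}  xs zero    = refl
  init-∷ʳ-last {suc n} xs zero    = refl
  init-∷ʳ-last {suc n} xs (suc i) = init-∷ʳ-last (tail xs) i

sumFin≡sum : ∀ n (g : Vector ℕ n) → sumFin n g ≡ sum g
sumFin≡sum zero    g = refl
sumFin≡sum (suc n) g = cong (g zero +_) (sumFin≡sum n (tail g))

sumFin-cong : ∀ n {f g : Vector ℕ n} → f ≗ g → sumFin n f ≡ sumFin n g
sumFin-cong n {f} {g} f≗g =
  trans (sumFin≡sum n f) (trans (sum-cong-≗ f≗g) (sym (sumFin≡sum n g)))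

sumFin-init-last : ∀ n (g : Vector ℕ (suc n)) → sumFin (suc n) g ≡ sumFin n (init g) + last g
sumFin-init-last n g =
  trans (sumFin≡sum (suc n) g) (trans (sum-init-last g) (cong (_+ last g) (sym (sumFin≡sum n (init g)))))

sumFin-+ : ∀ n (f g : Vector ℕ n) → sumFin n (λ i → f i + g i) ≡ sumFin n f + sumFin n g
sumFin-+ n f g = trans (sumFin≡sum n _)
  (trans (∑-distrib-+ f g) (sym (cong₂ _+_ (sumFin≡sum n f) (sumFin≡sum n g))))

sumFin-replicate-0 : ∀ n → sumFin n (replicate n 0) ≡ 0
sumFin-replicate-0 n = trans (sumFin≡sum n _) (sum-replicate-zero n)

sumFin-∷ʳ : ∀ n (d : Vector ℕ n) k → sumFin (suc n) (d ∷ʳ k) ≡ sumFin n d + k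
sumFin-∷ʳ n d k =
  trans (sumFin-init-last n (d ∷ʳ k)) (cong₂ _+_ (sumFin-cong n (init-∷ʳ d k)) (last-∷ʳ d k))

weightedFib-cong : ∀ n {d d′ : Vector ℕ n} → d ≗ d′ → weightedFib n d ≡ weightedFib n d′
weightedFib-cong n d≗d′ = sumFin-cong n (λ j → cong (_* fib (toℕ j + 2)) (d≗d′ j))

weightedFib-∷ʳ : ∀ n (d : Vector ℕ n) k →
                 weightedFib (suc n) (d ∷ʳ k) ≡ weightedFib n d + k * fib (suc (suc n))
weightedFib-∷ʳ n d k = trans (sumFin-init-last n (λ j → (d ∷ʳ k) j * fib (toℕ j + 2))) (cong₂ _+_
  (sumFin-cong n (λ i → cong₂ (λ x j → x * fib (j + 2)) (init-∷ʳ d k i) (toℕ-inject₁ i)))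
  (cong₂ (λ x j → x * fib j) (last-∷ʳ d k) (trans (cong (_+ 2) (toℕ-fromℕ n)) (+-comm n 2))))

weightedFib-+ : ∀ n (d e : Vector ℕ n) →
                weightedFib n (λ i → d i + e i) ≡ weightedFib n d + weightedFib n e
weightedFib-+ n d e =
  trans (sumFin-cong n (λ j → *-distribʳ-+ (fib (toℕ j + 2)) (d j) (e j)))
        (sumFin-+ n (λ j → d j * fib (toℕ j + 2)) (λ j → e j * fib (toℕ j + 2)))

0<fib[1+n] : ∀ n → 0 < fib (suc n)
0<fib[1+n] zero    = s≤s z≤n
0<fib[1+n] (suc n) = ≤-trans (0<fib[1+n] n) (m≤m+n _ _)

fib[3+n]+fib[n]≡2*fib[2+n] : ∀ n → fib (3 + n) + fib n ≡ 2 * fib (2 + n)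
fib[3+n]+fib[n]≡2*fib[2+n] n =
  trans (+-assoc (fib (2 + n)) (fib (1 + n)) (fib n)) (cong (fib (2 + n) +_) (sym (+-identityʳ _)))

fib-as-one-coin : ∀ n → Σ[ e ∈ Vector ℕ n ] (weightedFib n e ≡ fib n) × (sumFin n e ≤ 1)
fib-as-one-coin zero          = (λ ()) , refl , z≤n
fib-as-one-coin (suc zero)    = (λ _ → 1) , refl , ≤-refl
fib-as-one-coin (suc (suc m)) = (top ∷ʳ 0) , value , size
  where
  top = replicate m 0 ∷ʳ 1
  F   = fib (suc (suc m))

  value : weightedFib (suc (suc m)) (top ∷ʳ 0) ≡ F
  value = begin
    weightedFib (suc (suc m)) (top ∷ʳ 0)  ≡⟨ weightedFib-∷ʳ (suc m) top 0 ⟩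
    weightedFib (suc m) top + 0           ≡⟨ +-identityʳ _ ⟩
    weightedFib (suc m) top               ≡⟨ weightedFib-∷ʳ m (replicate m 0) 1 ⟩
    weightedFib m (replicate m 0) + 1 * F ≡⟨ cong₂ _+_ (sumFin-replicate-0 m) (*-identityˡ F) ⟩
    F                                     ∎
    where open ≡-Reasoning

  size : sumFin (suc (suc m)) (top ∷ʳ 0) ≤ 1
  size = ≤-reflexive (begin
    sumFin (suc (suc m)) (top ∷ʳ 0)  ≡⟨ sumFin-∷ʳ (suc m) top 0 ⟩
    sumFin (suc m) top + 0           ≡⟨ +-identityʳ _ ⟩
    sumFin (suc m) top               ≡⟨ sumFin-∷ʳ m (replicate m 0) 1 ⟩
    sumFin m (replicate m 0) + 1     ≡⟨ cong (_+ 1) (sumFin-replicate-0 m) ⟩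
    1                                ∎)
    where open ≡-Reasoning

Removable : (n : ℕ) → ℕ → Vector ℕ n → Set
Removable n T d = Σ[ c ∈ Vector ℕ n ]
  (weightedFib n d ≡ T + weightedFib n c) × (sumFin n c < sumFin n d)

AlwaysRemovable : ℕ → ℕ → Set
AlwaysRemovable n T = ∀ d → T ≤ weightedFib n d → Removable n T d

removable-cong : ∀ n {T} {d d′ : Vector ℕ n} → d ≗ d′ → Removable n T d → Removable n T d′
removable-cong n d≗d′ (c , value , size) =
  c , trans (sym (weightedFib-cong n d≗d′)) value , subst (_ <_) (sumFin-cong n d≗d′) size

alwaysRemovable-∷ʳ : ∀ n {T} →
  (∀ d₀ k → T ≤ weightedFib (suc n) (d₀ ∷ʳ k) → Removable (suc n) T (d₀ ∷ʳ k)) →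
  AlwaysRemovable (suc n) T
alwaysRemovable-∷ʳ n {T} removable d T≤d = removable-cong (suc n) {T} (init-∷ʳ-last d)
  (removable (init d) (last d) (subst (T ≤_) (sym (weightedFib-cong (suc n) (init-∷ʳ-last d))) T≤d))

removable-+ : ∀ n {T₁ T₀} {d : Vector ℕ n} → Removable n T₁ d → AlwaysRemovable n T₀ →
              T₁ + T₀ ≤ weightedFib n d → Removable n (T₁ + T₀) d
removable-+ n {T₁} {T₀} (c₁ , value₁ , size₁) removable₀ T≤d
  with removable₀ c₁ (+-cancelˡ-≤ T₁ T₀ _ (subst (T₁ + T₀ ≤_) value₁ T≤d))
... | c₀ , value₀ , size₀ =
  c₀ , trans value₁ (trans (cong (T₁ +_) value₀) (sym (+-assoc T₁ T₀ _))) , <-trans size₀ size₁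

removable-∷ʳ : ∀ n {T T₀} j {d₀ : Vector ℕ n} → T ≡ j * fib (suc (suc n)) + T₀ →
               Removable n T₀ d₀ → Removable (suc n) T (d₀ ∷ʳ j)
removable-∷ʳ n {T} {T₀} j {d₀} T≡ (c₀ , value₀ , size₀) = c₀ ∷ʳ 0 , value , size
  where
  F = fib (suc (suc n))

  value : weightedFib (suc n) (d₀ ∷ʳ j) ≡ T + weightedFib (suc n) (c₀ ∷ʳ 0)
  value = begin
    weightedFib (suc n) (d₀ ∷ʳ j)         ≡⟨ weightedFib-∷ʳ n d₀ j ⟩
    weightedFib n d₀ + j * F              ≡⟨ cong (_+ j * F) value₀ ⟩
    (T₀ + weightedFib n c₀) + j * F       ≡⟨ shuffle T₀ (weightedFib n c₀) (j * F) ⟩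
    (j * F + T₀) + (weightedFib n c₀ + 0) ≡⟨ cong₂ _+_ (sym T≡) (sym (weightedFib-∷ʳ n c₀ 0)) ⟩
    T + weightedFib (suc n) (c₀ ∷ʳ 0)     ∎
    where
    open ≡-Reasoning
    shuffle : ∀ t c x → (t + c) + x ≡ (x + t) + (c + 0)
    shuffle = solve-∀

  size : sumFin (suc n) (c₀ ∷ʳ 0) < sumFin (suc n) (d₀ ∷ʳ j)
  size = begin-strict
    sumFin (suc n) (c₀ ∷ʳ 0) ≡⟨ trans (sumFin-∷ʳ n c₀ 0) (+-identityʳ _) ⟩
    sumFin n c₀              <⟨ size₀ ⟩
    sumFin n d₀              ≤⟨ m≤m+n _ j ⟩
    sumFin n d₀ + j          ≡⟨ sumFin-∷ʳ n d₀ j ⟨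
    sumFin (suc n) (d₀ ∷ʳ j) ∎
    where open ≤-Reasoning

affordable-init : ∀ n {T T₀} j (d₀ : Vector ℕ n) → T ≡ j * fib (suc (suc n)) + T₀ →
                  T ≤ weightedFib (suc n) (d₀ ∷ʳ j) → T₀ ≤ weightedFib n d₀
affordable-init n j d₀ T≡ T≤d = +-cancelˡ-≤ (j * F) _ _
  (subst₂ _≤_ T≡ (trans (weightedFib-∷ʳ n d₀ j) (+-comm _ (j * F))) T≤d)
  where F = fib (suc (suc n))

removable-below-top : ∀ n {T T₀} j → T ≡ j * fib (suc (suc n)) + T₀ → AlwaysRemovable n T₀ →
                      ∀ d₀ → T ≤ weightedFib (suc n) (d₀ ∷ʳ j) → Removable (suc n) T (d₀ ∷ʳ j)
removable-below-top n j T≡ removable₀ d₀ T≤d =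
  removable-∷ʳ n j T≡ (removable₀ d₀ (affordable-init n j d₀ T≡ T≤d))

removable-by-exchange : ∀ n {T} j (e : Vector ℕ n) → T + weightedFib n e ≡ j * fib (suc (suc n)) →
                        sumFin n e < j → ∀ d₀ k → Removable (suc n) T (d₀ ∷ʳ (j + k))
removable-by-exchange n {T} j e T+e≡ e<j d₀ k = (d₀+e ∷ʳ k) , value , size
  where
  F    = fib (suc (suc n))
  d₀+e = λ i → d₀ i + e i

  value : weightedFib (suc n) (d₀ ∷ʳ (j + k)) ≡ T + weightedFib (suc n) (d₀+e ∷ʳ k)
  value = begin
    weightedFib (suc n) (d₀ ∷ʳ (j + k))                       ≡⟨ weightedFib-∷ʳ n d₀ (j + k) ⟩
    weightedFib n d₀ + (j + k) * F                            ≡⟨ cong (weightedFib n d₀ +_) (*-distribʳ-+ F j k) ⟩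
    weightedFib n d₀ + (j * F + k * F)                        ≡⟨ cong (λ x → weightedFib n d₀ + (x + k * F)) (sym T+e≡) ⟩
    weightedFib n d₀ + ((T + weightedFib n e) + k * F)        ≡⟨ shuffle (weightedFib n d₀) T (weightedFib n e) (k * F) ⟩
    T + ((weightedFib n d₀ + weightedFib n e) + k * F)        ≡⟨ cong (λ x → T + (x + k * F)) (sym (weightedFib-+ n d₀ e)) ⟩
    T + (weightedFib n d₀+e + k * F)                          ≡⟨ cong (T +_) (sym (weightedFib-∷ʳ n d₀+e k)) ⟩
    T + weightedFib (suc n) (d₀+e ∷ʳ k)                       ∎
    where
    open ≡-Reasoning
    shuffle : ∀ d t e x → d + ((t + e) + x) ≡ t + ((d + e) + x)
    shuffle = solve-∀

  size : sumFin (suc n) (d₀+e ∷ʳ k) < sumFin (suc n) (d₀ ∷ʳ (j + k))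
  size = begin-strict
    sumFin (suc n) (d₀+e ∷ʳ k)          ≡⟨ sumFin-∷ʳ n d₀+e k ⟩
    sumFin n d₀+e + k                   ≡⟨ cong (_+ k) (sumFin-+ n d₀ e) ⟩
    (sumFin n d₀ + sumFin n e) + k      <⟨ +-monoˡ-< k (+-monoʳ-< (sumFin n d₀) e<j) ⟩
    (sumFin n d₀ + j) + k               ≡⟨ +-assoc (sumFin n d₀) j k ⟩
    sumFin n d₀ + (j + k)               ≡⟨ sumFin-∷ʳ n d₀ (j + k) ⟨
    sumFin (suc n) (d₀ ∷ʳ (j + k))      ∎
    where open ≤-Reasoning

fib-alwaysRemovable : ∀ n t → AlwaysRemovable n (fib (t + suc n))
fib-alwaysRemovable zero t d fib≤0 =
  ⊥-elim (<⇒≱ (subst (λ k → 0 < fib k) (+-comm 1 t) (0<fib[1+n] t)) fib≤0)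
fib-alwaysRemovable (suc n) zero = alwaysRemovable-∷ʳ n λ where
  d₀ zero      → removable-below-top n 0 refl (fib-alwaysRemovable n 1) d₀
  d₀ (suc k) _ → removable-by-exchange n 1 (replicate n 0)
    (cong (fib (suc (suc n)) +_) (sumFin-replicate-0 n)) (s≤s (≤-reflexive (sumFin-replicate-0 n))) d₀ k
fib-alwaysRemovable (suc n) (suc zero) = alwaysRemovable-∷ʳ n λ where
  d₀ zero          → removable-below-top n 0 refl (fib-alwaysRemovable n 2) d₀
  d₀ (suc zero)    → removable-below-top n 1 (cong (_+ fib (suc n)) (sym (*-identityˡ _)))
                       (fib-alwaysRemovable n 0) d₀
  d₀ (suc (suc k)) _ → let e , value , size = fib-as-one-coin n in
    removable-by-exchange n 2 e (trans (cong (fib (3 + n) +_) value) (fib[3+n]+fib[n]≡2*fib[2+n] n))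
      (s≤s size) d₀ k
fib-alwaysRemovable (suc n) (suc (suc t)) d T≤d =
  removable-+ (suc n) {d = d} (fib-alwaysRemovable (suc n) (suc t) d (≤-trans (m≤m+n _ _) T≤d))
    (fib-alwaysRemovable (suc n) t) T≤d

lemma13 : (a : ℕ) → 3 ≤ a → (d : Fin (a ∸ 2) → ℕ)
          → fib a ≤ weightedFib (a ∸ 2) d
          → Σ[ c ∈ (Fin (a ∸ 2) → ℕ) ]
              ((weightedFib (a ∸ 2) d ≡ fib a + weightedFib (a ∸ 2) c)
               × (sumFin (a ∸ 2) c < sumFin (a ∸ 2) d))
lemma13 (suc (suc (suc m))) _ d fib≤d = fib-alwaysRemovable (suc m) 1 d fib≤d
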